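{- Let $n\ge1$, $m\ge2$, $1\le r\le m$. Then (i) $T(n,m,r)$ has exactly $(r,m)$ $I$-cycles and each $I$-cycle contains exactly $\frac{m}{(r,m)}$ columns; (ii) any $(r,m)$ consecutive columns (the $j$-, $(j+1)$-, \dots, $(j+(r,m)-1)$-columns, indices mod $m$) lie on pairwise different $I$-cycles; (iii) the $j$-column and the $(j+h)$-column (index mod $m$) belong to the same $I$-cycle if and only if $(r,m)\mid h$.
   Context: Write $Z_k=\{0,1,\dots,k-1\}$. $T(n,m,r)$ is the graph with vertex set $\{v_{i,j}: i\in Z_n, j\in Z_m\}$ (second index modulo $m$) with horizontal edges $v_{i,j}v_{i,j+1}$ and vertical edges $v_{i,j}v_{i+1,j}$ ($0\le i\le n-2$) and $v_{n-1,j}v_{0,j+r}$ ($j\in Z_m$). For $j\in Z_m$ the $j$-column is the path $v_{0,j}v_{1,j}\cdots v_{n-1,j}$; the $(j+r)$-column is the successor of the $j$-column (its initial vertex $v_{0,j+r}$ is adjacent to the terminal vertex $v_{n-1,j}$). If $j_0,\dots,j_{g-1}$ are pairwise distinct and the $j_{t+1}$-column is the successor of the $j_t$-column for each $t\in Z_g$ (indices of $t$ mod $g$), then these $g$ columns together with the connecting vertical edges form a cycle, called an $I$-cycle. $(r,m)$ denotes the greatest common divisor. -}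

module Defs where

open import Data.Nat using (ℕ; zero; suc; _+_; _%_)
open import Data.Nat.DivMod using (m%n<n)
open import Data.Fin using (Fin; toℕ; fromℕ<)
open import Data.Product using (Σ; ∃; _×_)
open import Function.Definitions using (Injective)
open import Relation.Binary.PropositionalEquality using (_≡_)
open import Function.Bundles using (_⇔_)

shift : (k : ℕ) → Fin k → ℕ → Fin k
shift zero () h
shift (suc k) j h = fromℕ< (m%n<n (toℕ j + h) (suc k))

-- In T(n,m,r) the successor of the j-column is the (j+r)-column
-- (the terminal vertex v_{n-1,j} is adjacent to v_{0,j+r}).
successorColumn : (n m r : ℕ) → Fin m → Fin m
successorColumn n m r j = shift m j r

-- An I-cycle of T(n,m,r): pairwise distinct columns j_0,…,j_{g-1} (g ≥ 1)
-- such that the j_{t+1}-column is the successor of the j_t-column (t mod g).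
-- g = suc g' enforces g ≥ 1.
record ICycle (n m r : ℕ) : Set where
  field
    g'     : ℕ
    column : Fin (suc g') → Fin m
    distinct : Injective _≡_ _≡_ column
    succ-ok  : ∀ (t : Fin (suc g')) →
               column (shift (suc g') t 1) ≡ successorColumn n m r (column t)

  size : ℕ
  size = suc g'

open ICycle public

_∈C_ : ∀ {n m r} → Fin m → ICycle n m r → Set
j ∈C C = ∃ λ t → column C t ≡ j

-- Two I-cycles are the same cycle (subgraph) iff they consist of the same
-- columns (an I-cycle is its columns plus connecting vertical edges).
SameCycle : ∀ {n m r} → ICycle n m r → ICycle n m r → Set
SameCycle C D = ∀ j → (j ∈C C) ⇔ (j ∈C D)

-- The successor map j ↦ j + r on Z_m moves along every I-cycle, so the columns of an I-cycle
-- through c are exactly the points c + k·r (mod m).  By Bézout, r·u ≡ d (mod m) for d = (r,m),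
-- hence these are exactly the columns ≡ c (mod d): the I-cycles are the d residue classes.
-- Closing up forces m ∣ g·r, i.e. m/d ∣ g, while (m/d)·r ≡ 0 together with distinctness of
-- the columns forces g ≤ m/d; so every I-cycle has m/d columns.
module Submission where

open import Defs
open import Data.Nat using (ℕ; zero; suc; s≤s; _+_; _*_; _∸_; _%_; _/_; _≤_; _<_; NonZero; pred; ≢-nonZero)
open import Data.Nat.Properties
open import Data.Nat.DivMod
open import Data.Nat.Divisibility using (_∣_; m%n≡0⇒n∣m; ∣⇒≤; *-cancelʳ-∣; ∣n⇒∣m*n; 0∣⇒≡0)
open import Data.Nat.GCD using (gcd; GCD; gcd-GCD; module Bézout)
open import Data.Fin using (Fin; toℕ; fromℕ<; zero; inject≤)
open import Data.Fin.Properties using (toℕ-injective; toℕ<n; toℕ-fromℕ<; toℕ-inject≤)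
open import Data.Vec using (Vec; lookup; tabulate)
open import Data.Vec.Properties using (lookup∘tabulate)
open import Data.Product using (Σ; ∃; _×_; _,_; proj₁; proj₂)
open import Relation.Nullary using (¬_)
open import Relation.Binary.PropositionalEquality
open import Function.Bundles using (_⇔_; mk⇔; Equivalence)
open import Function.Definitions using (Injective)
import Function.Properties.Equivalence as ⇔
open import Data.Nat.Tactic.RingSolver using (solve-∀)
open import Algebra.Properties.CommutativeSemigroup *-commutativeSemigroup
  using (x∙yz≈y∙xz; x∙yz≈z∙xy; x∙yz≈x∙zy)

open Equivalence

[m%n+k]%n≡[m+k]%n : ∀ m k n .{{_ : NonZero n}} → (m % n + k) % n ≡ (m + k) % n
[m%n+k]%n≡[m+k]%n m k n = begin
  (m % n + k) % n          ≡⟨ %-distribˡ-+ (m % n) k n ⟩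
  (m % n % n + k % n) % n  ≡⟨ cong (λ x → (x + k % n) % n) (m%n%n≡m%n m n) ⟩
  (m % n + k % n) % n      ≡⟨ %-distribˡ-+ m k n ⟨
  (m + k) % n              ∎
  where open ≡-Reasoning

+-congˡ-% : ∀ k {a b} n .{{_ : NonZero n}} → a % n ≡ b % n → (k + a) % n ≡ (k + b) % n
+-congˡ-% k {a} {b} n eq = begin
  (k + a) % n          ≡⟨ %-distribˡ-+ k a n ⟩
  (k % n + a % n) % n  ≡⟨ cong (λ x → (k % n + x) % n) eq ⟩
  (k % n + b % n) % n  ≡⟨ %-distribˡ-+ k b n ⟨
  (k + b) % n          ∎
  where open ≡-Reasoning

*-congˡ-% : ∀ k {a b} n .{{_ : NonZero n}} → a % n ≡ b % n → (k * a) % n ≡ (k * b) % n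
*-congˡ-% k {a} {b} n eq = begin
  (k * a) % n            ≡⟨ %-distribˡ-* k a n ⟩
  (k % n * (a % n)) % n  ≡⟨ cong (λ x → (k % n * x) % n) eq ⟩
  (k % n * (b % n)) % n  ≡⟨ %-distribˡ-* k b n ⟨
  (k * b) % n            ∎
  where open ≡-Reasoning

-- Adding k·(n − 1) turns k + x into x + k·n.
+-cancelˡ-% : ∀ k {a b} n .{{_ : NonZero n}} → (k + a) % n ≡ (k + b) % n → a % n ≡ b % n
+-cancelˡ-% k {a} {b} n@(suc n′) eq = begin
  a % n                   ≡⟨ [m+kn]%n≡m%n a k n ⟨
  (a + k * n) % n         ≡⟨ cong (_% n) (absorb k n′ a) ⟩
  (k * n′ + (k + a)) % n  ≡⟨ +-congˡ-% (k * n′) n eq ⟩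
  (k * n′ + (k + b)) % n  ≡⟨ cong (_% n) (absorb k n′ b) ⟨
  (b + k * n) % n         ≡⟨ [m+kn]%n≡m%n b k n ⟩
  b % n                   ∎
  where
  open ≡-Reasoning
  absorb : ∀ k n′ x → x + k * suc n′ ≡ k * n′ + (k + x)
  absorb = solve-∀

m%n≡[m+k]%n⇔n∣k : ∀ m k n .{{_ : NonZero n}} → (m % n ≡ (m + k) % n) ⇔ (n ∣ k)
m%n≡[m+k]%n⇔n∣k m k n@(suc _) = mk⇔
  (λ eq → m%n≡0⇒n∣m k n (sym (+-cancelˡ-% m {0} n (trans (cong (_% n) (+-identityʳ m)) eq))))
  (λ n∣k → sym (%-remove-+ʳ m n∣k))

bézout-% : ∀ {r m′ d} → GCD r (suc m′) d → ∃ λ u → (r * u) % suc m′ ≡ d % suc m′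
bézout-% {r} {m′} {d} d-gcd with Bézout.identity d-gcd
... | Bézout.+- x y eq = x , (begin
  (r * x) % m      ≡⟨ cong (_% m) (trans (*-comm r x) (sym eq)) ⟩
  (d + y * m) % m  ≡⟨ [m+kn]%n≡m%n d y m ⟩
  d % m            ∎)
  where open ≡-Reasoning; m = suc m′
-- Here x·r ≡ −d, and x·m′ ≡ −x (mod m).
... | Bézout.-+ x y eq = x * m′ , (begin
  (r * (x * m′)) % m                ≡⟨ [m+kn]%n≡m%n (r * (x * m′)) y m ⟨
  (r * (x * m′) + y * m) % m        ≡⟨ cong (λ z → (r * (x * m′) + z) % m) eq ⟨
  (r * (x * m′) + (d + x * r)) % m  ≡⟨ cong (_% m) (collect r x m′ d) ⟩
  (d + x * r * m) % m               ≡⟨ [m+kn]%n≡m%n d (x * r) m ⟩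
  d % m                             ∎)
  where
  open ≡-Reasoning; m = suc m′
  collect : ∀ r x m′ d → r * (x * m′) + (d + x * r) ≡ d + x * r * suc m′
  collect = solve-∀

module _ {k : ℕ} where
  private K = suc k

  toℕ-shift : ∀ (j : Fin K) h → toℕ (shift K j h) ≡ (toℕ j + h) % K
  toℕ-shift j h = toℕ-fromℕ< _

  shift-cong : ∀ (j : Fin K) {a b} → a % K ≡ b % K → shift K j a ≡ shift K j b
  shift-cong j {a} {b} eq = toℕ-injective (begin
    toℕ (shift K j a)  ≡⟨ toℕ-shift j a ⟩
    (toℕ j + a) % K    ≡⟨ +-congˡ-% (toℕ j) K eq ⟩
    (toℕ j + b) % K    ≡⟨ toℕ-shift j b ⟨
    toℕ (shift K j b)  ∎)
    where open ≡-Reasoning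

  shift-cancel : ∀ (j : Fin K) {a b} → shift K j a ≡ shift K j b → a % K ≡ b % K
  shift-cancel j {a} {b} eq = +-cancelˡ-% (toℕ j) K (begin
    (toℕ j + a) % K    ≡⟨ toℕ-shift j a ⟨
    toℕ (shift K j a)  ≡⟨ cong toℕ eq ⟩
    toℕ (shift K j b)  ≡⟨ toℕ-shift j b ⟩
    (toℕ j + b) % K    ∎)
    where open ≡-Reasoning

  shift-identityʳ : ∀ (j : Fin K) → shift K j 0 ≡ j
  shift-identityʳ j = toℕ-injective (begin
    toℕ (shift K j 0)  ≡⟨ toℕ-shift j 0 ⟩
    (toℕ j + 0) % K    ≡⟨ cong (_% K) (+-identityʳ (toℕ j)) ⟩
    toℕ j % K          ≡⟨ m<n⇒m%n≡m (toℕ<n j) ⟩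
    toℕ j              ∎)
    where open ≡-Reasoning

  shift-size : ∀ (j : Fin K) → shift K j K ≡ j
  shift-size j = trans (shift-cong j (n%n≡0 K)) (shift-identityʳ j)

  shift-zero : ∀ (t : Fin K) → shift K zero (toℕ t) ≡ t
  shift-zero t = toℕ-injective (trans (toℕ-shift zero (toℕ t)) (m<n⇒m%n≡m (toℕ<n t)))

  shift-shift : ∀ (j : Fin K) a b → shift K (shift K j a) b ≡ shift K j (a + b)
  shift-shift j a b = toℕ-injective (begin
    toℕ (shift K (shift K j a) b)  ≡⟨ toℕ-shift (shift K j a) b ⟩
    (toℕ (shift K j a) + b) % K    ≡⟨ cong (λ x → (x + b) % K) (toℕ-shift j a) ⟩
    ((toℕ j + a) % K + b) % K      ≡⟨ [m%n+k]%n≡[m+k]%n (toℕ j + a) b K ⟩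
    (toℕ j + a + b) % K            ≡⟨ cong (_% K) (+-assoc (toℕ j) a b) ⟩
    (toℕ j + (a + b)) % K          ≡⟨ toℕ-shift j (a + b) ⟨
    toℕ (shift K j (a + b))        ∎)
    where open ≡-Reasoning

  shift-by-difference : ∀ (c j : Fin K) → shift K c (toℕ j + (K ∸ toℕ c)) ≡ j
  shift-by-difference c j = toℕ-injective (begin
    toℕ (shift K c (toℕ j + (K ∸ toℕ c)))  ≡⟨ toℕ-shift c _ ⟩
    (toℕ c + (toℕ j + (K ∸ toℕ c))) % K    ≡⟨ cong (_% K) (swap (toℕ c) (toℕ j) _) ⟩
    (toℕ j + (toℕ c + (K ∸ toℕ c))) % K    ≡⟨ cong (λ x → (toℕ j + x) % K) (m+[n∸m]≡n (<⇒≤ (toℕ<n c))) ⟩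
    (toℕ j + K) % K                        ≡⟨ [m+n]%n≡m%n (toℕ j) K ⟩
    toℕ j % K                              ≡⟨ m<n⇒m%n≡m (toℕ<n j) ⟩
    toℕ j                                  ∎)
    where
    open ≡-Reasoning
    swap : ∀ x y z → x + (y + z) ≡ y + (x + z)
    swap = solve-∀

  %-shift : ∀ {d} .{{_ : NonZero d}} → d ∣ K → ∀ (j : Fin K) h →
            toℕ (shift K j h) % d ≡ (toℕ j + h) % d
  %-shift {d} d∣K j h = trans (cong (_% d) (toℕ-shift j h)) (m∣n⇒o%n%m≡o%m d K _ d∣K)

module ICycles (n m′ r d : ℕ) (d-gcd : GCD r (suc m′) d) where

  m : ℕ
  m = suc m′

  d∣r : d ∣ r
  d∣r = GCD.gcd∣m d-gcd

  d∣m : d ∣ m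
  d∣m = GCD.gcd∣n d-gcd

  instance
    d≢0 : NonZero d
    d≢0 = ≢-nonZero λ d≡0 → 1+n≢0 (0∣⇒≡0 (subst (_∣ m) d≡0 d∣m))

  d≤m : d ≤ m
  d≤m = ∣⇒≤ d∣m

  -- q = m / d, written as a successor so that Fin q can index the columns of an I-cycle.
  q′ q : ℕ
  q′ = pred (_∣_.quotient d∣m)
  q = suc q′

  m≡q*d : m ≡ q * d
  m≡q*d = trans m≡[m/d]*d (cong (_* d) (positive (_∣_.quotient d∣m) m≡[m/d]*d))
    where
    m≡[m/d]*d = _∣_.equality d∣m
    positive : ∀ {a} b → suc a ≡ b * d → b ≡ suc (pred b)
    positive (suc _) _ = refl

  q*r%m≡0 : (q * r) % m ≡ 0
  q*r%m≡0 = begin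
    (q * r) % m        ≡⟨ cong (λ x → (q * x) % m) (_∣_.equality d∣r) ⟩
    (q * (s * d)) % m  ≡⟨ cong (_% m) (x∙yz≈y∙xz q s d) ⟩
    (s * (q * d)) % m  ≡⟨ cong (λ x → (s * x) % m) m≡q*d ⟨
    (s * m) % m        ≡⟨ m*n%n≡0 s m ⟩
    0                  ∎
    where
    open ≡-Reasoning
    s = _∣_.quotient d∣r

  [k%q]*r%m≡[k*r]%m : ∀ k → (k % q * r) % m ≡ (k * r) % m
  [k%q]*r%m≡[k*r]%m k = sym (begin
    (k * r) % m                        ≡⟨ cong (λ x → (x * r) % m) (m≡m%n+[m/n]*n k q) ⟩
    ((k % q + k / q * q) * r) % m      ≡⟨ cong (_% m) (*-distribʳ-+ r (k % q) (k / q * q)) ⟩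
    (k % q * r + k / q * q * r) % m    ≡⟨ cong (λ x → (k % q * r + x) % m) (*-assoc (k / q) q r) ⟩
    (k % q * r + k / q * (q * r)) % m  ≡⟨ +-congˡ-% (k % q * r) m (*-congˡ-% (k / q) m q*r%m≡0) ⟩
    (k % q * r + k / q * 0) % m        ≡⟨ cong (λ x → (k % q * r + x) % m) (*-zeroʳ (k / q)) ⟩
    (k % q * r + 0) % m                ≡⟨ cong (_% m) (+-identityʳ (k % q * r)) ⟩
    (k % q * r) % m                    ∎)
    where open ≡-Reasoning

  u : ℕ
  u = proj₁ (bézout-% d-gcd)

  r*u%m≡d%m : (r * u) % m ≡ d % m
  r*u%m≡d%m = proj₂ (bézout-% d-gcd)

  *r-%⇒*d-% : ∀ a b → (a * r) % m ≡ (b * r) % m → (a * d) % m ≡ (b * d) % m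
  *r-%⇒*d-% a b eq = begin
    (a * d) % m        ≡⟨ *-congˡ-% a m r*u%m≡d%m ⟨
    (a * (r * u)) % m  ≡⟨ cong (_% m) (x∙yz≈z∙xy a r u) ⟩
    (u * (a * r)) % m  ≡⟨ *-congˡ-% u m eq ⟩
    (u * (b * r)) % m  ≡⟨ cong (_% m) (x∙yz≈z∙xy b r u) ⟨
    (b * (r * u)) % m  ≡⟨ *-congˡ-% b m r*u%m≡d%m ⟩
    (b * d) % m        ∎
    where
    open ≡-Reasoning

  Reachable : Fin m → Fin m → Set
  Reachable c j = ∃ λ k → shift m c (k * r) ≡ j

  reachable⇔%d : ∀ c j → Reachable c j ⇔ (toℕ c % d ≡ toℕ j % d)
  reachable⇔%d c j = mk⇔ reach⇒ ⇒reach
    where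
    open ≡-Reasoning
    reach⇒ : Reachable c j → toℕ c % d ≡ toℕ j % d
    reach⇒ (k , eq) = begin
      toℕ c % d                    ≡⟨ %-remove-+ʳ (toℕ c) (∣n⇒∣m*n k d∣r) ⟨
      (toℕ c + k * r) % d          ≡⟨ %-shift d∣m c (k * r) ⟨
      toℕ (shift m c (k * r)) % d  ≡⟨ cong (λ x → toℕ x % d) eq ⟩
      toℕ j % d                    ∎
    ⇒reach : toℕ c % d ≡ toℕ j % d → Reachable c j
    ⇒reach c≡j = l * u , (begin
      shift m c (l * u * r)  ≡⟨ shift-cong c l*u*r≡e ⟩
      shift m c e            ≡⟨ shift-by-difference c j ⟩
      j                      ∎)
      where
      e = toℕ j + (m ∸ toℕ c)
      d∣e : d ∣ e
      d∣e = to (m%n≡[m+k]%n⇔n∣k (toℕ c) e d) (begin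
        toℕ c % d              ≡⟨ c≡j ⟩
        toℕ j % d              ≡⟨ cong (λ x → toℕ x % d) (shift-by-difference c j) ⟨
        toℕ (shift m c e) % d  ≡⟨ %-shift d∣m c e ⟩
        (toℕ c + e) % d        ∎)
      l = _∣_.quotient d∣e
      l*u*r≡e : (l * u * r) % m ≡ e % m
      l*u*r≡e = begin
        (l * u * r) % m    ≡⟨ cong (_% m) (trans (*-assoc l u r) (x∙yz≈x∙zy l u r)) ⟩
        (l * (r * u)) % m  ≡⟨ *-congˡ-% l m r*u%m≡d%m ⟩
        (l * d) % m        ≡⟨ cong (_% m) (_∣_.equality d∣e) ⟨
        e % m              ∎

  module _ (C : ICycle n m r) where

    column-shift : ∀ k t → column C (shift (size C) t k) ≡ shift m (column C t) (k * r)
    column-shift zero    t =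
      trans (cong (column C) (shift-identityʳ t)) (sym (shift-identityʳ (column C t)))
    column-shift (suc k) t = begin
      column C (shift g t (suc k))              ≡⟨ cong (column C) (shift-shift t 1 k) ⟨
      column C (shift g (shift g t 1) k)        ≡⟨ column-shift k (shift g t 1) ⟩
      shift m (column C (shift g t 1)) (k * r)  ≡⟨ cong (λ c → shift m c (k * r)) (succ-ok C t) ⟩
      shift m (shift m (column C t) r) (k * r)  ≡⟨ shift-shift (column C t) r (k * r) ⟩
      shift m (column C t) (suc k * r)          ∎
      where
      open ≡-Reasoning
      g = size C

    ∈C⇔reachable : ∀ j → j ∈C C ⇔ Reachable (column C zero) j
    ∈C⇔reachable j = mk⇔
      (λ (t , eq) → toℕ t , (begin
        shift m (column C zero) (toℕ t * r)     ≡⟨ column-shift (toℕ t) zero ⟨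
        column C (shift (size C) zero (toℕ t))  ≡⟨ cong (column C) (shift-zero t) ⟩
        column C t                              ≡⟨ eq ⟩
        j                                       ∎))
      (λ (k , eq) → shift (size C) zero k , trans (column-shift k zero) eq)
      where open ≡-Reasoning

    ∈C⇔%d : ∀ j → j ∈C C ⇔ (toℕ (column C zero) % d ≡ toℕ j % d)
    ∈C⇔%d j = ⇔.trans (∈C⇔reachable j) (reachable⇔%d (column C zero) j)

    q≤size : q ≤ size C
    q≤size = ∣⇒≤ (*-cancelʳ-∣ d (subst (_∣ size C * d) m≡q*d m∣size*d))
      where
      size*r%m≡0 : (size C * r) % m ≡ 0
      size*r%m≡0 = shift-cancel (column C zero) (begin
        shift m (column C zero) (size C * r)     ≡⟨ column-shift (size C) zero ⟨
        column C (shift (size C) zero (size C))  ≡⟨ cong (column C) (shift-size zero) ⟩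
        column C zero                            ≡⟨ shift-identityʳ (column C zero) ⟨
        shift m (column C zero) 0                ∎)
        where open ≡-Reasoning
      m∣size*d : m ∣ size C * d
      m∣size*d = m%n≡0⇒n∣m _ m (*r-%⇒*d-% (size C) 0 size*r%m≡0)

    size≤q : size C ≤ q
    size≤q = ≮⇒≥ λ q<size → 1+n≢0 (begin
      q                            ≡⟨ m<n⇒m%n≡m q<size ⟨
      q % size C                   ≡⟨ toℕ-shift zero q ⟨
      toℕ (shift (size C) zero q)  ≡⟨ cong toℕ (distinct C wraps) ⟩
      0                            ∎)
      where
      open ≡-Reasoning
      wraps : column C (shift (size C) zero q) ≡ column C zero
      wraps = begin
        column C (shift (size C) zero q)  ≡⟨ column-shift q zero ⟩
        shift m (column C zero) (q * r)   ≡⟨ shift-cong (column C zero) q*r%m≡0 ⟩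
        shift m (column C zero) 0         ≡⟨ shift-identityʳ (column C zero) ⟩
        column C zero                     ∎

    size*d≡m : size C * d ≡ m
    size*d≡m = trans (cong (_* d) (≤-antisym size≤q q≤size)) (sym m≡q*d)

  orbit : Fin m → ICycle n m r
  orbit c = record { g' = q′ ; column = col ; distinct = injective ; succ-ok = step }
    where
    open ≡-Reasoning
    col : Fin q → Fin m
    col t = shift m c (toℕ t * r)
    below : ∀ (t : Fin q) → toℕ t * d < m
    below t = subst (toℕ t * d <_) (sym m≡q*d) (*-monoˡ-< d (toℕ<n t))
    injective : Injective _≡_ _≡_ col
    injective {t} {t′} eq = toℕ-injective (*-cancelʳ-≡ (toℕ t) (toℕ t′) d (begin
      toℕ t * d         ≡⟨ m<n⇒m%n≡m (below t) ⟨
      (toℕ t * d) % m   ≡⟨ *r-%⇒*d-% (toℕ t) (toℕ t′) (shift-cancel c eq) ⟩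
      (toℕ t′ * d) % m  ≡⟨ m<n⇒m%n≡m (below t′) ⟩
      toℕ t′ * d        ∎))
    *-suc-distribʳ : ∀ k → (k + 1) * r ≡ k * r + r
    *-suc-distribʳ k = trans (*-distribʳ-+ r k 1) (cong (k * r +_) (*-identityˡ r))
    step : ∀ t → col (shift q t 1) ≡ successorColumn n m r (col t)
    step t = begin
      shift m c (toℕ (shift q t 1) * r)  ≡⟨ cong (λ x → shift m c (x * r)) (toℕ-shift t 1) ⟩
      shift m c ((toℕ t + 1) % q * r)    ≡⟨ shift-cong c ([k%q]*r%m≡[k*r]%m (toℕ t + 1)) ⟩
      shift m c ((toℕ t + 1) * r)        ≡⟨ cong (shift m c) (*-suc-distribʳ (toℕ t)) ⟩
      shift m c (toℕ t * r + r)          ≡⟨ shift-shift c (toℕ t * r) r ⟨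
      shift m (col t) r                  ∎

  ∈orbit⇔%d : ∀ c j → j ∈C orbit c ⇔ (toℕ c % d ≡ toℕ j % d)
  ∈orbit⇔%d c j =
    subst (λ x → j ∈C orbit c ⇔ (toℕ x % d ≡ toℕ j % d)) (shift-identityʳ c) (∈C⇔%d (orbit c) j)

  co-cyclic⇔%d : ∀ i j →
    (∃ λ (C : ICycle n m r) → i ∈C C × j ∈C C) ⇔ (toℕ i % d ≡ toℕ j % d)
  co-cyclic⇔%d i j = mk⇔
    (λ (C , i∈C , j∈C) → trans (sym (to (∈C⇔%d C i) i∈C)) (to (∈C⇔%d C j) j∈C))
    (λ i≡j → orbit i , (zero , shift-identityʳ i) , from (∈orbit⇔%d i j) i≡j)

  orbitOf : Fin d → ICycle n m r
  orbitOf a = orbit (inject≤ a d≤m)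

  orbits : Vec (ICycle n m r) d
  orbits = tabulate orbitOf

  toℕ-inject≤-%d : ∀ (a : Fin d) → toℕ (inject≤ a d≤m) % d ≡ toℕ a
  toℕ-inject≤-%d a = trans (cong (_% d) (toℕ-inject≤ a d≤m)) (m<n⇒m%n≡m (toℕ<n a))

  ∈orbits⇔ : ∀ a j → j ∈C lookup orbits a ⇔ (toℕ a ≡ toℕ j % d)
  ∈orbits⇔ a j =
    subst (λ C → j ∈C C ⇔ (toℕ a ≡ toℕ j % d)) (sym (lookup∘tabulate orbitOf a))
      (subst (λ x → j ∈C orbitOf a ⇔ (x ≡ toℕ j % d)) (toℕ-inject≤-%d a)
        (∈orbit⇔%d (inject≤ a d≤m) j))

  orbits-distinct : ∀ a b → a ≢ b → ¬ SameCycle (lookup orbits a) (lookup orbits b)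
  orbits-distinct a b a≢b same =
    a≢b (toℕ-injective (trans (to (∈orbits⇔ a j) j∈a) (sym (to (∈orbits⇔ b j) j∈b))))
    where
    j = inject≤ a d≤m
    j∈a : j ∈C lookup orbits a
    j∈a = from (∈orbits⇔ a j) (sym (toℕ-inject≤-%d a))
    j∈b : j ∈C lookup orbits b
    j∈b = to (same j) j∈a

  orbits-cover : ∀ (C : ICycle n m r) → ∃ λ a → SameCycle C (lookup orbits a)
  orbits-cover C = a , λ j → ⇔.trans (∈C⇔%d C j) (⇔.sym (∈a⇔ j))
    where
    a = fromℕ< (m%n<n (toℕ (column C zero)) d)
    ∈a⇔ : ∀ j → j ∈C lookup orbits a ⇔ (toℕ (column C zero) % d ≡ toℕ j % d)
    ∈a⇔ j =
      subst (λ x → j ∈C lookup orbits a ⇔ (x ≡ toℕ j % d)) (toℕ-fromℕ< _) (∈orbits⇔ a j)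

  consecutive-apart : ∀ j (a b : Fin d) → a ≢ b →
    ¬ (∃ λ (C : ICycle n m r) → shift m j (toℕ a) ∈C C × shift m j (toℕ b) ∈C C)
  consecutive-apart j a b a≢b co-cyclic = a≢b (toℕ-injective (begin
    toℕ a      ≡⟨ m<n⇒m%n≡m (toℕ<n a) ⟨
    toℕ a % d  ≡⟨ +-cancelˡ-% (toℕ j) d j+a≡j+b ⟩
    toℕ b % d  ≡⟨ m<n⇒m%n≡m (toℕ<n b) ⟩
    toℕ b      ∎))
    where
    open ≡-Reasoning
    j+a≡j+b : (toℕ j + toℕ a) % d ≡ (toℕ j + toℕ b) % d
    j+a≡j+b = begin
      (toℕ j + toℕ a) % d          ≡⟨ %-shift d∣m j (toℕ a) ⟨
      toℕ (shift m j (toℕ a)) % d  ≡⟨ to (co-cyclic⇔%d _ _) co-cyclic ⟩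
      toℕ (shift m j (toℕ b)) % d  ≡⟨ %-shift d∣m j (toℕ b) ⟩
      (toℕ j + toℕ b) % d          ∎

  co-cyclic-shift⇔∣ : ∀ j h →
    (∃ λ (C : ICycle n m r) → j ∈C C × shift m j h ∈C C) ⇔ (d ∣ h)
  co-cyclic-shift⇔∣ j h = ⇔.trans (co-cyclic⇔%d j (shift m j h))
    (subst (λ x → (toℕ j % d ≡ x) ⇔ (d ∣ h)) (sym (%-shift d∣m j h))
      (m%n≡[m+k]%n⇔n∣k (toℕ j) h d))

corollary2p6 : (n m r : ℕ) → 1 ≤ n → 2 ≤ m → 1 ≤ r → r ≤ m →
    -- (i) exactly (r,m) I-cycles, each with exactly m/(r,m) columns
    (Σ (Vec (ICycle n m r) (gcd r m)) λ cs →
       (∀ (a b : Fin (gcd r m)) → a ≢ b → ¬ SameCycle (lookup cs a) (lookup cs b))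
       × (∀ (C : ICycle n m r) → ∃ λ a → SameCycle C (lookup cs a)))
    × (∀ (C : ICycle n m r) → size C * gcd r m ≡ m)
    -- (ii) (r,m) consecutive columns lie on pairwise different I-cycles
    × (∀ (j : Fin m) (a b : Fin (gcd r m)) → a ≢ b →
         ¬ (∃ λ (C : ICycle n m r) → (shift m j (toℕ a) ∈C C) × (shift m j (toℕ b) ∈C C)))
    -- (iii) j-column and (j+h)-column on the same I-cycle iff (r,m) ∣ h
    × (∀ (j : Fin m) (h : ℕ) →
         (∃ λ (C : ICycle n m r) → (j ∈C C) × (shift m j h ∈C C)) ⇔ (gcd r m ∣ h))
corollary2p6 n (suc m′) r _ (s≤s _) _ _ =
  (orbits , orbits-distinct , orbits-cover) , size*d≡m , consecutive-apart , co-cyclic-shift⇔∣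
  where open ICycles n m′ r (gcd r (suc m′)) (gcd-GCD r (suc m′))
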